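{- The ring $R_\Delta=\mathcal{O}_K/\mathcal{M}_\Delta$ is interpretable in the structure $(H_\Delta,\cdot,\Sigma,0,1,P_\Delta)$ uniformly for all valued fields $K$ and all convex $\Delta\subseteq\Gamma$ with $0\in\Delta$: there are formulas in the language $\{\cdot,\Sigma,0,1,P\}$ ($P$ a unary predicate) defining an equivalence relation $E$ on $H_\Delta$ and relations on $H_\Delta/E$ interpreting $+,\cdot,0,1$, such that for every valued field $K$ and every such $\Delta$ the resulting structure is a ring isomorphic to $R_\Delta$.
   Context: $K$ is a valued field with valuation $v$, valuation ring $\mathcal{O}_K$, value group $\Gamma$. "Convex" means: $h\in\Delta$ and $g\le h$ imply $g\in\Delta$. $\mathcal{M}_\Delta=\{x\in K: v(x)>\gamma\text{ for all }\gamma\in\Delta\}$. $H_\Delta=K/(1+\mathcal{M}_\Delta)$ is the set of orbits $x(1+\mathcal{M}_\Delta)$, with multiplication of representatives, constants $0=\{0\}$, $1=1+\mathcal{M}_\Delta$, and $\Sigma(X,Y,Z)$ holding iff there exist $\alpha\in X,\beta\in Y$ with $\alpha+\beta\in Z$. $P_\Delta=\{x(1+\mathcal{M}_\Delta): v(x)\ge0\}$. -}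

module Defs where

open import Level using (Level; _⊔_; suc; Setω)
open import Algebra.Bundles using (CommutativeRing)
open import Algebra.Structures using (IsAbelianGroup)
open import Relation.Binary.Structures using (IsTotalOrder)
open import Relation.Binary.PropositionalEquality using (_≡_)
open import Relation.Nullary using (¬_)
open import Data.Product using (Σ; ∃; _×_; _,_)
open import Data.Sum using (_⊎_)
open import Data.Empty using (⊥)
open import Data.Unit using (⊤)
import Data.Nat
open Data.Nat using (ℕ)
open import Data.Fin using (Fin)
open import Data.Vec using (Vec; lookup; _∷_; [])
open import Function.Bundles using (_⇔_)

data WithTop {g} (Γ : Set g) : Set g where
  fin : Γ → WithTop Γ
  ∞   : WithTop Γ

module _ {g} {Γ : Set g} where
  lift≤ : (Γ → Γ → Set g) → WithTop Γ → WithTop Γ → Set g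
  lift≤ _≤_ (fin a) (fin b) = a ≤ b
  lift≤ _≤_ (fin a) ∞       = Level.Lift g ⊤
  lift≤ _≤_ ∞       (fin b) = Level.Lift g ⊥
  lift≤ _≤_ ∞       ∞       = Level.Lift g ⊤

  lift⊕ : (Γ → Γ → Γ) → WithTop Γ → WithTop Γ → WithTop Γ
  lift⊕ _⊕_ (fin a) (fin b) = fin (a ⊕ b)
  lift⊕ _⊕_ (fin a) ∞       = ∞
  lift⊕ _⊕_ ∞       _       = ∞

record ValuedField (c ℓ g : Level) : Set (suc (c ⊔ ℓ ⊔ g)) where
  field
    commRing : CommutativeRing c ℓ
  open CommutativeRing commRing public
  field
    1≉0     : ¬ (1# ≈ 0#)
    inverse : ∀ x → ¬ (x ≈ 0#) → ∃ λ y → x * y ≈ 1#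
    Γ       : Set g
    _⊕_     : Γ → Γ → Γ
    0Γ      : Γ
    ⊖_      : Γ → Γ
    _≤Γ_    : Γ → Γ → Set g
    isAbelianGroupΓ : IsAbelianGroup _≡_ _⊕_ 0Γ ⊖_
    isTotalOrderΓ   : IsTotalOrder _≡_ _≤Γ_
    ⊕-mono-≤        : ∀ {a b} c′ → a ≤Γ b → (a ⊕ c′) ≤Γ (b ⊕ c′)

  field
    v        : Carrier → WithTop Γ
    v-cong   : ∀ {x y} → x ≈ y → v x ≡ v y
    v-∞      : ∀ x → (v x ≡ ∞) ⇔ (x ≈ 0#)
    v-mul    : ∀ x y → v (x * y) ≡ lift⊕ _⊕_ (v x) (v y)
    v-add    : ∀ x y → lift≤ _≤Γ_ (v x) (v (x + y)) ⊎ lift≤ _≤Γ_ (v y) (v (x + y))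
    v-surj   : ∀ γ → ∃ λ x → v x ≡ fin γ

  _≤∞_ : WithTop Γ → WithTop Γ → Set g
  _≤∞_ = lift≤ _≤Γ_

  _<∞_ : WithTop Γ → WithTop Γ → Set g
  a <∞ b = (a ≤∞ b) × ¬ (a ≡ b)

  𝒪 : Carrier → Set g
  𝒪 x = fin 0Γ ≤∞ v x

module _ {c ℓ g} (K : ValuedField c ℓ g) where
  open ValuedField K

  Convex : ∀ {d} → (Γ → Set d) → Set (g ⊔ d)
  Convex Δ = ∀ {γ δ} → Δ δ → γ ≤Γ δ → Δ γ

  module _ {d} (Δ : Γ → Set d) where

    𝓜 : Carrier → Set (g ⊔ d)
    𝓜 x = ∀ γ → Δ γ → fin γ <∞ v x

    -- congruence modulo 𝓜_Δ (equality in R_Δ = 𝒪_K / 𝓜_Δ)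
    _≡𝓜_ : Carrier → Carrier → Set (g ⊔ d)
    a ≡𝓜 b = 𝓜 (a + (- b))

    -- equality in H_Δ = K/(1+𝓜_Δ): y ∈ x(1+𝓜_Δ)
    _∼H_ : Carrier → Carrier → Set (c ⊔ ℓ ⊔ g ⊔ d)
    x ∼H y = ∃ λ m → 𝓜 m × (y ≈ x * (1# + m))

    ΣH : Carrier → Carrier → Carrier → Set (c ⊔ ℓ ⊔ g ⊔ d)
    ΣH x y z = ∃ λ α → ∃ λ β → (x ∼H α) × (y ∼H β) × (z ∼H (α + β))

data Term (n : ℕ) : Set where
  var  : Fin n → Term n
  `0   : Term n
  `1   : Term n
  _`·_ : Term n → Term n → Term n

data Formula (n : ℕ) : Set where
  _`≐_ : Term n → Term n → Formula n
  `Σ   : Term n → Term n → Term n → Formula n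
  `P   : Term n → Formula n
  `⊥   : Formula n
  _`∧_ : Formula n → Formula n → Formula n
  _`∨_ : Formula n → Formula n → Formula n
  _`⇒_ : Formula n → Formula n → Formula n
  `∀   : Formula (Data.Nat.suc n) → Formula n
  `∃   : Formula (Data.Nat.suc n) → Formula n

-- structures for the language {·, Σ, 0, 1, P}; equality is interpreted
-- by the given relation _≐_ (the equality of the structure).
record LStructure (a b : Level) : Set (suc (a ⊔ b)) where
  field
    Dom  : Set a
    _≐_  : Dom → Dom → Set b
    _·_  : Dom → Dom → Dom
    𝟘 𝟙  : Dom
    ΣR   : Dom → Dom → Dom → Set b
    PR   : Dom → Set b

module _ {a b} (𝔄 : LStructure a b) where
  open LStructure 𝔄

  evalT : ∀ {n} → Term n → Vec Dom n → Dom
  evalT (var i)  ρ = lookup ρ i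
  evalT `0       ρ = 𝟘
  evalT `1       ρ = 𝟙
  evalT (s `· t) ρ = evalT s ρ · evalT t ρ

  Sat : ∀ {n} → Formula n → Vec Dom n → Set (a ⊔ b)
  Sat (s `≐ t)   ρ = Level.Lift (a ⊔ b) (evalT s ρ ≐ evalT t ρ)
  Sat (`Σ s t u) ρ = Level.Lift (a ⊔ b) (ΣR (evalT s ρ) (evalT t ρ) (evalT u ρ))
  Sat (`P t)     ρ = Level.Lift (a ⊔ b) (PR (evalT t ρ))
  Sat `⊥         ρ = Level.Lift (a ⊔ b) ⊥
  Sat (φ `∧ ψ)   ρ = Sat φ ρ × Sat ψ ρ
  Sat (φ `∨ ψ)   ρ = Sat φ ρ ⊎ Sat ψ ρ
  Sat (φ `⇒ ψ)   ρ = Sat φ ρ → Sat ψ ρ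
  Sat (`∀ φ)     ρ = (x : Dom) → Sat φ (x ∷ ρ)
  Sat (`∃ φ)     ρ = Σ Dom (λ x → Sat φ (x ∷ ρ))

-- the data of a (one-dimensional, full-domain) interpretation of a ring:
-- a formula for the equivalence relation E, and formulas for the graphs of
-- +, ·, and for 0, 1.
record InterpretationFormulas : Set where
  field
    φE : Formula 2
    φ+ : Formula 3
    φ· : Formula 3
    φ0 : Formula 1
    φ1 : Formula 1

module _ {c ℓ g} (K : ValuedField c ℓ g) where
  open ValuedField K

  HStr : ∀ {d} → (Γ → Set d) → LStructure c (c ⊔ ℓ ⊔ g ⊔ d)
  HStr {d} Δ = record
    { Dom = Carrier
    ; _≐_ = _∼H_ K Δ
    ; _·_ = _*_
    ; 𝟘   = 0#
    ; 𝟙   = 1#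
    ; ΣR  = ΣH K Δ
    ; PR  = λ x → Level.Lift (c ⊔ ℓ ⊔ g ⊔ d) (𝒪 x)
    }

  -- The formulas (φE, φ+, φ·, φ0, φ1) interpret the ring R_Δ = 𝒪_K/𝓜_Δ in
  -- H_Δ: there is a map f from H_Δ into 𝒪_K, surjective modulo 𝓜_Δ, such
  -- that φE defines exactly the kernel of f (mod 𝓜_Δ) and φ+, φ·, φ0, φ1
  -- define exactly the pullbacks along f of the graphs of +, ·, 0, 1 of R_Δ.
  -- Hence E is an equivalence relation on H_Δ and f induces an isomorphism
  -- from the interpreted structure on H_Δ/E onto the ring R_Δ.
  Interprets : ∀ {d} (Δ : Γ → Set d) → InterpretationFormulas →
               Set (c ⊔ ℓ ⊔ g ⊔ d)
  Interprets Δ Φ =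
    Σ (Carrier → Carrier) λ f →
        (∀ x → 𝒪 (f x))
      × (∀ a → 𝒪 a → ∃ λ x → _≡𝓜_ K Δ (f x) a)
      × (∀ x y → Sat H φE (x ∷ y ∷ []) ⇔ _≡𝓜_ K Δ (f x) (f y))
      × (∀ x y z → Sat H φ+ (x ∷ y ∷ z ∷ []) ⇔ _≡𝓜_ K Δ (f x + f y) (f z))
      × (∀ x y z → Sat H φ· (x ∷ y ∷ z ∷ []) ⇔ _≡𝓜_ K Δ (f x * f y) (f z))
      × (∀ x → Sat H φ0 (x ∷ []) ⇔ _≡𝓜_ K Δ (f x) 0#)
      × (∀ x → Sat H φ1 (x ∷ []) ⇔ _≡𝓜_ K Δ (f x) 1#)
    where H = HStr Δ
          open InterpretationFormulas Φ

-- existential quantifier whose body lives in Setω (needed for uniformity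
-- over all universe levels)
record ∃ω {A : Set} (P : A → Setω) : Setω where
  constructor _,ω_
  field
    witness : A
    proof   : P witness

-- Let f : K → 𝒪_K be the retraction sending x to itself when x ∈ 𝒪_K and to
-- 0 otherwise.  The interpretation identifies an element x of H_Δ with the
-- residue of f(x) modulo 𝓜_Δ, using three first-order gadgets:
--   * M(z) := Σ(1, z, 1) defines 𝓜_Δ, since 1 + z ∈ 1(1+𝓜_Δ) iff z ∈ 𝓜_Δ;
--   * D(a, b) := ∃z (M(z) ∧ Σ(b, z, a)) defines congruence modulo 𝓜_Δ on 𝒪_K;
--   * F(x, u) := (P(x) ∧ u = x) ∨ (¬P(x) ∧ u = 0) defines the graph of f.
-- Addition is defined through Σ, multiplication through the product of H_Δ.

module Submission where

open import Defs
open import Level using (_⊔_; Lift; lift; lower)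
open import Axiom.ExcludedMiddle using (ExcludedMiddle)

open import Algebra.Bundles using (Group)
open import Algebra.Structures using (IsAbelianGroup)
open import Relation.Binary.Bundles using (Setoid)
open import Relation.Binary.Structures using (IsPartialOrder; IsTotalOrder)
open import Relation.Binary.PropositionalEquality as ≡ using (_≡_; subst; subst₂; cong; cong₂)
open import Relation.Nullary using (¬_; yes; no)
open import Data.Product using (Σ; _×_; _,_; proj₁; proj₂)
open import Data.Sum using (_⊎_; inj₁; inj₂)
open import Data.Empty using (⊥-elim)
open import Data.Unit using (tt)
import Data.Nat as ℕ
open import Data.Fin using (zero; suc; #_)
open import Data.Vec using (_∷_; [])
open import Function.Bundles using (_⇔_; mk⇔; Equivalence)

module ExtendedOrder {g} {Γ : Set g} {_≤_ : Γ → Γ → Set g}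
                     (isPartialOrder : IsPartialOrder _≡_ _≤_) where
  open IsPartialOrder isPartialOrder using (antisym) renaming (refl to ≤-refl; trans to ≤-trans)

  private
    _≤∞_ : WithTop Γ → WithTop Γ → Set g
    _≤∞_ = lift≤ _≤_

  ≤∞-refl : ∀ a → a ≤∞ a
  ≤∞-refl (fin a) = ≤-refl
  ≤∞-refl ∞       = lift tt

  ≤∞-top : ∀ a → a ≤∞ ∞
  ≤∞-top (fin a) = lift tt
  ≤∞-top ∞       = lift tt

  ≤∞-trans : ∀ {a b e} → a ≤∞ b → b ≤∞ e → a ≤∞ e
  ≤∞-trans {fin a} {fin b} {fin e} p q = ≤-trans p q
  ≤∞-trans {fin a} {_}     {∞}     p q = lift tt
  ≤∞-trans {fin a} {∞}     {fin e} p (lift ())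
  ≤∞-trans {∞}     {fin b}         (lift ()) q
  ≤∞-trans {∞}     {∞}     {fin e} p (lift ())
  ≤∞-trans {∞}     {∞}     {∞}     p q = lift tt

  ≤∞-antisym : ∀ {a b} → a ≤∞ b → b ≤∞ a → a ≡ b
  ≤∞-antisym {fin a} {fin b} p q = cong fin (antisym p q)
  ≤∞-antisym {fin a} {∞}     p (lift ())
  ≤∞-antisym {∞}     {fin b} (lift ()) q
  ≤∞-antisym {∞}     {∞}     p q = ≡.refl

  <-≤∞-trans : ∀ {a b e} → (a ≤∞ b) × ¬ (a ≡ b) → b ≤∞ e → (a ≤∞ e) × ¬ (a ≡ e)
  <-≤∞-trans {a} {b} {e} (a≤b , a≢b) b≤e =
    ≤∞-trans {a} {b} {e} a≤b b≤e ,
    λ a≡e → a≢b (≤∞-antisym {a} {b} a≤b (subst (b ≤∞_) (≡.sym a≡e) b≤e))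

module OrderedGroup {g} {Γ : Set g} {_⊕_ : Γ → Γ → Γ} {0Γ : Γ} {⊖_ : Γ → Γ}
                    {_≤_ : Γ → Γ → Set g}
                    (isAbelianGroup : IsAbelianGroup _≡_ _⊕_ 0Γ ⊖_)
                    (isTotalOrder : IsTotalOrder _≡_ _≤_)
                    (⊕-mono-≤ : ∀ {a b} e → a ≤ b → (a ⊕ e) ≤ (b ⊕ e)) where
  open IsAbelianGroup isAbelianGroup using (identityˡ; identityʳ)
  open IsTotalOrder isTotalOrder using (total; isPartialOrder)
  open ExtendedOrder isPartialOrder using (≤∞-top)

  private
    group : Group g g
    group = record { isGroup = IsAbelianGroup.isGroup isAbelianGroup }

  open import Algebra.Properties.Group group using (loop)
  open import Algebra.Properties.Loop loop using (identityʳ-unique)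

  idempotent⇒identity : ∀ a → a ⊕ a ≡ a → a ≡ 0Γ
  idempotent⇒identity a = identityʳ-unique a a

  self-inverse⇒nonnegative : ∀ a → a ⊕ a ≡ 0Γ → 0Γ ≤ a
  self-inverse⇒nonnegative a a⊕a≡0 with total 0Γ a
  ... | inj₁ 0≤a = 0≤a
  ... | inj₂ a≤0 = subst₂ _≤_ a⊕a≡0 (identityˡ a) (⊕-mono-≤ a a≤0)

  ≤-plus-nonnegative : ∀ a b → lift≤ _≤_ (fin 0Γ) a → lift≤ _≤_ b (lift⊕ _⊕_ a b)
  ≤-plus-nonnegative ∞       b       _   = ≤∞-top b
  ≤-plus-nonnegative (fin a) ∞       _   = lift tt
  ≤-plus-nonnegative (fin a) (fin b) 0≤a = subst (_≤ (a ⊕ b)) (identityˡ b) (⊕-mono-≤ b 0≤a)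

  plus-zero : ∀ a → lift⊕ _⊕_ a (fin 0Γ) ≡ a
  plus-zero (fin a) = cong fin (identityʳ a)
  plus-zero ∞       = ≡.refl

module Valuation {c ℓ g} (K : ValuedField c ℓ g) where
  open ValuedField K
  open import Algebra.Properties.Ring ring using (-‿involutive; -0#≈0#; -1*x≈-x)
  open ExtendedOrder (IsTotalOrder.isPartialOrder isTotalOrderΓ) public
    using (≤∞-refl; ≤∞-trans; ≤∞-antisym; <-≤∞-trans)
  open OrderedGroup isAbelianGroupΓ isTotalOrderΓ ⊕-mono-≤ public
    using (idempotent⇒identity; self-inverse⇒nonnegative; ≤-plus-nonnegative; plus-zero)

  fin-injective : ∀ {a b : Γ} → fin a ≡ fin b → a ≡ b
  fin-injective ≡.refl = ≡.refl

  v-zero : v 0# ≡ ∞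
  v-zero = Equivalence.from (v-∞ 0#) refl

  v-∞⇒zero : ∀ {x} → v x ≡ ∞ → x ≈ 0#
  v-∞⇒zero {x} = Equivalence.to (v-∞ x)

  v-one : v 1# ≡ fin 0Γ
  v-one with v 1# in eq
  ... | ∞     = ⊥-elim (1≉0 (v-∞⇒zero eq))
  ... | fin a = cong fin (idempotent⇒identity a (fin-injective a⊕a≡a))
    where
    a⊕a≡a : fin (a ⊕ a) ≡ fin a
    a⊕a≡a = ≡.trans (≡.sym (≡.trans (v-mul 1# 1#) (cong₂ (lift⊕ _⊕_) eq eq)))
                    (≡.trans (v-cong (*-identityˡ 1#)) eq)

  𝒪-resp-v : ∀ {x y} → v x ≡ v y → 𝒪 x → 𝒪 y
  𝒪-resp-v eq = subst (fin 0Γ ≤∞_) eq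

  𝒪-zero : 𝒪 0#
  𝒪-zero = subst (fin 0Γ ≤∞_) (≡.sym v-zero) (lift tt)

  𝒪-one : 𝒪 1#
  𝒪-one = subst (fin 0Γ ≤∞_) (≡.sym v-one) (≤∞-refl (fin 0Γ))

  -- -1 is a unit of 𝒪: its value is of order two in Γ, hence nonnegative.
  𝒪-minus-one : 𝒪 (- 1#)
  𝒪-minus-one with v (- 1#) in eq
  ... | ∞     = ⊥-elim (1≉0 (trans (sym (-‿involutive 1#))
                                    (trans (-‿cong (v-∞⇒zero eq)) -0#≈0#)))
  ... | fin a = self-inverse⇒nonnegative a (fin-injective a⊕a≡0)
    where
    a⊕a≡0 : fin (a ⊕ a) ≡ fin 0Γ
    a⊕a≡0 = ≡.trans (≡.sym (≡.trans (v-mul (- 1#) (- 1#)) (cong₂ (lift⊕ _⊕_) eq eq)))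
                    (≡.trans (v-cong (-1*x≈-x (- 1#))) (≡.trans (v-cong (-‿involutive 1#)) v-one))

  v-≤-scaled : ∀ o x → 𝒪 o → v x ≤∞ v (o * x)
  v-≤-scaled o x 𝒪o = subst (v x ≤∞_) (≡.sym (v-mul o x)) (≤-plus-nonnegative (v o) (v x) 𝒪o)

  𝒪-+ : ∀ {x y} → 𝒪 x → 𝒪 y → 𝒪 (x + y)
  𝒪-+ {x} {y} 𝒪x 𝒪y with v-add x y
  ... | inj₁ p = ≤∞-trans {fin 0Γ} {v x} 𝒪x p
  ... | inj₂ p = ≤∞-trans {fin 0Γ} {v y} 𝒪y p

  𝒪-* : ∀ {x y} → 𝒪 x → 𝒪 y → 𝒪 (x * y)
  𝒪-* {x} {y} 𝒪x 𝒪y = ≤∞-trans {fin 0Γ} {v y} 𝒪y (v-≤-scaled x y 𝒪x)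

module Ideal {c ℓ g d} (K : ValuedField c ℓ g) (Δ : ValuedField.Γ K → Set d)
             (Δ0 : Δ (ValuedField.0Γ K)) where
  open ValuedField K
  open Valuation K
  open import Algebra.Properties.Ring ring
    using (x≈y⇒x∙y⁻¹≈ε; ⁻¹-anti-homo‿-; -‿+-comm; -0#≈0#; -1*x≈-x; x[y-z]≈xy-xz; [y-z]x≈yx-zx)

  𝓜Δ : Carrier → Set (g ⊔ d)
  𝓜Δ = 𝓜 K Δ

  infix 4 _≋_
  _≋_ : Carrier → Carrier → Set (g ⊔ d)
  _≋_ = _≡𝓜_ K Δ

  𝓜-resp-v : ∀ {x y} → v x ≡ v y → 𝓜Δ x → 𝓜Δ y
  𝓜-resp-v eq mx γ γ∈Δ = subst (fin γ <∞_) eq (mx γ γ∈Δ)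

  𝓜-resp-≈ : ∀ {x y} → x ≈ y → 𝓜Δ x → 𝓜Δ y
  𝓜-resp-≈ eq = 𝓜-resp-v (v-cong eq)

  𝓜-zero : 𝓜Δ 0#
  𝓜-zero γ _ = subst (fin γ <∞_) (≡.sym v-zero) (lift tt , λ ())

  𝓜-+ : ∀ {x y} → 𝓜Δ x → 𝓜Δ y → 𝓜Δ (x + y)
  𝓜-+ {x} {y} mx my γ γ∈Δ with v-add x y
  ... | inj₁ p = <-≤∞-trans (mx γ γ∈Δ) p
  ... | inj₂ p = <-≤∞-trans (my γ γ∈Δ) p

  𝓜-scale : ∀ {o x} → 𝒪 o → 𝓜Δ x → 𝓜Δ (o * x)
  𝓜-scale {o} {x} 𝒪o mx γ γ∈Δ = <-≤∞-trans (mx γ γ∈Δ) (v-≤-scaled o x 𝒪o)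

  𝓜-neg : ∀ {x} → 𝓜Δ x → 𝓜Δ (- x)
  𝓜-neg {x} mx = 𝓜-resp-≈ (-1*x≈-x x) (𝓜-scale 𝒪-minus-one mx)

  -- Since 0 ∈ Δ, elements of 𝓜_Δ have positive value.
  𝓜⊆𝒪 : ∀ {m} → 𝓜Δ m → 𝒪 m
  𝓜⊆𝒪 mm = proj₁ (mm 0Γ Δ0)

  ≈⇒≋ : ∀ {a b} → a ≈ b → a ≋ b
  ≈⇒≋ a≈b = 𝓜-resp-≈ (sym (x≈y⇒x∙y⁻¹≈ε a≈b)) 𝓜-zero

  ≋-sym : ∀ {a b} → a ≋ b → b ≋ a
  ≋-sym {a} {b} h = 𝓜-resp-≈ (⁻¹-anti-homo‿- a b) (𝓜-neg h)

  ≋-trans : ∀ {a b e} → a ≋ b → b ≋ e → a ≋ e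
  ≋-trans {a} {b} {e} h₁ h₂ = 𝓜-resp-≈ telescope (𝓜-+ h₁ h₂)
    where
    open import Relation.Binary.Reasoning.Setoid setoid
    telescope : (a - b) + (b - e) ≈ a - e
    telescope = begin
      (a - b) + (b - e)   ≈⟨ +-assoc a (- b) (b - e) ⟩
      a + (- b + (b - e)) ≈⟨ +-congˡ (+-assoc (- b) b (- e)) ⟨
      a + ((- b + b) - e) ≈⟨ +-congˡ (+-congʳ (-‿inverseˡ b)) ⟩
      a + (0# - e)        ≈⟨ +-congˡ (+-identityˡ (- e)) ⟩
      a - e               ∎

  ≋-setoid : Setoid c (g ⊔ d)
  ≋-setoid = record
    { Carrier = Carrier
    ; _≈_ = _≋_
    ; isEquivalence = record { refl = ≈⇒≋ refl ; sym = ≋-sym ; trans = ≋-trans }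
    }

  ≋-+ : ∀ {a a′ b b′} → a ≋ a′ → b ≋ b′ → a + b ≋ a′ + b′
  ≋-+ {a} {a′} {b} {b′} h₁ h₂ = 𝓜-resp-≈ regroup (𝓜-+ h₁ h₂)
    where
    open import Algebra.Properties.CommutativeSemigroup +-commutativeSemigroup using (interchange)
    regroup : (a - a′) + (b - b′) ≈ (a + b) - (a′ + b′)
    regroup = trans (interchange a (- a′) b (- b′)) (+-congˡ (-‿+-comm a′ b′))

  ≋-neg : ∀ {a b} → a ≋ b → - a ≋ - b
  ≋-neg {a} {b} h = 𝓜-resp-≈ (sym (-‿+-comm a (- b))) (𝓜-neg h)

  -- Multiplication respects ≋ on 𝒪: ab ≋ a′b ≋ a′b′.
  ≋-* : ∀ {a a′ b b′} → 𝒪 a′ → 𝒪 b → a ≋ a′ → b ≋ b′ → a * b ≋ a′ * b′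
  ≋-* {a} {a′} {b} {b′} 𝒪a′ 𝒪b h₁ h₂ =
    ≋-trans (𝓜-resp-≈ (trans (*-comm b (a - a′)) ([y-z]x≈yx-zx b a a′)) (𝓜-scale 𝒪b h₁))
            (𝓜-resp-≈ (x[y-z]≈xy-xz a′ b b′) (𝓜-scale 𝒪a′ h₂))

  𝓜⇒≋0 : ∀ {m} → 𝓜Δ m → m ≋ 0#
  𝓜⇒≋0 {m} = 𝓜-resp-≈ (sym (trans (+-congˡ -0#≈0#) (+-identityʳ m)))

  ≋0⇒𝓜 : ∀ {m} → m ≋ 0# → 𝓜Δ m
  ≋0⇒𝓜 {m} = 𝓜-resp-≈ (trans (+-congˡ -0#≈0#) (+-identityʳ m))

-- The units 1 + 𝓜_Δ: they have value 0, so the classes of H_Δ = K/(1 + 𝓜_Δ)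
-- have a well-defined value, and on 𝒪 they lie within one residue class.
module Units {c ℓ g d} (K : ValuedField c ℓ g) (Δ : ValuedField.Γ K → Set d)
             (Δ0 : Δ (ValuedField.0Γ K)) where
  open ValuedField K
  open Valuation K
  open Ideal K Δ Δ0
  open import Algebra.Properties.Ring ring using (xyx⁻¹≈y)

  infix 4 _∼_
  _∼_ : Carrier → Carrier → Set (c ⊔ ℓ ⊔ g ⊔ d)
  _∼_ = _∼H_ K Δ

  -- v(1 + m) = 0: it is ≥ 0 as 1, m ∈ 𝒪, and ≤ 0 since 1 = (1 + m) - m
  -- where -m has positive value.
  v-unit : ∀ {m} → 𝓜Δ m → v (1# + m) ≡ fin 0Γ
  v-unit {m} mm = ≤∞-antisym {v (1# + m)} {fin 0Γ} at-most-zero at-least-zero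
    where
    at-least-zero : fin 0Γ ≤∞ v (1# + m)
    at-least-zero = 𝒪-+ 𝒪-one (𝓜⊆𝒪 mm)
    v-one′ : v ((1# + m) - m) ≡ fin 0Γ
    v-one′ = ≡.trans (v-cong (trans (+-congʳ (+-comm 1# m)) (xyx⁻¹≈y m 1#))) v-one
    at-most-zero : v (1# + m) ≤∞ fin 0Γ
    at-most-zero with v-add (1# + m) (- m)
    ... | inj₁ p = subst (v (1# + m) ≤∞_) v-one′ p
    ... | inj₂ p = ⊥-elim (proj₂ (<-≤∞-trans (𝓜-neg mm 0Γ Δ0) (subst (v (- m) ≤∞_) v-one′ p)) ≡.refl)

  ∼-preserves-v : ∀ {x y} → x ∼ y → v x ≡ v y
  ∼-preserves-v {x} {y} (m , mm , y≈x[1+m]) =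
    ≡.sym (≡.trans (v-cong y≈x[1+m])
          (≡.trans (v-mul x (1# + m)) (≡.trans (cong (lift⊕ _⊕_ (v x)) (v-unit mm)) (plus-zero (v x)))))

  ≈⇒∼ : ∀ {x y} → x ≈ y → x ∼ y
  ≈⇒∼ {x} x≈y = 0# , 𝓜-zero , trans (sym x≈y) (sym (trans (*-congˡ (+-identityʳ 1#)) (*-identityʳ x)))

  -- On 𝒪, x(1 + m) = x + xm ≋ x.
  ∼⇒≋ : ∀ {x y} → 𝒪 x → x ∼ y → x ≋ y
  ∼⇒≋ {x} {y} 𝒪x (m , mm , y≈x[1+m]) = begin
    x           ≈⟨ ≈⇒≋ (+-identityʳ x) ⟨
    x + 0#      ≈⟨ ≋-+ (≈⇒≋ refl) (𝓜⇒≋0 (𝓜-scale 𝒪x mm)) ⟨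
    x + x * m   ≈⟨ ≈⇒≋ (trans (distribˡ x 1# m) (+-congʳ (*-identityʳ x))) ⟨
    x * (1# + m) ≈⟨ ≈⇒≋ y≈x[1+m] ⟨
    y           ∎
    where open import Relation.Binary.Reasoning.Setoid ≋-setoid

module SumRelation {c ℓ g d} (K : ValuedField c ℓ g) (Δ : ValuedField.Γ K → Set d)
                   (Δ0 : Δ (ValuedField.0Γ K)) where
  open ValuedField K
  open Valuation K
  open Ideal K Δ Δ0
  open Units K Δ Δ0
  open import Algebra.Properties.Ring ring using (xyx⁻¹≈y; //-rightDividesˡ)

  Σ-sound : ∀ {x y z} → 𝒪 x → 𝒪 y → ΣH K Δ x y z → 𝒪 z × (x + y ≋ z)
  Σ-sound {x} {y} {z} 𝒪x 𝒪y (α , β , x∼α , y∼β , z∼α+β) = 𝒪z , x+y≋z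
    where
    𝒪α+β : 𝒪 (α + β)
    𝒪α+β = 𝒪-+ (𝒪-resp-v (∼-preserves-v x∼α) 𝒪x) (𝒪-resp-v (∼-preserves-v y∼β) 𝒪y)
    𝒪z : 𝒪 z
    𝒪z = 𝒪-resp-v (≡.sym (∼-preserves-v z∼α+β)) 𝒪α+β
    x+y≋z : x + y ≋ z
    x+y≋z = ≋-trans (≋-+ (∼⇒≋ 𝒪x x∼α) (∼⇒≋ 𝒪y y∼β)) (≋-sym (∼⇒≋ 𝒪z z∼α+β))

  Σ-complete : ∀ x y → ΣH K Δ x y (x + y)
  Σ-complete x y = x , y , ≈⇒∼ refl , ≈⇒∼ refl , ≈⇒∼ refl

  -- Σ(1, z, 1) holds iff z ∈ 𝓜_Δ: it says 1 + z ≋ 1.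
  Σ-unit-sound : ∀ {z} → ΣH K Δ 1# z 1# → 𝓜Δ z
  Σ-unit-sound {z} (α , β , 1∼α , z∼β , 1∼α+β) = 𝓜-resp-v (≡.sym (∼-preserves-v z∼β)) (≋0⇒𝓜 β≋0)
    where
    open import Relation.Binary.Reasoning.Setoid ≋-setoid
    β≋0 : β ≋ 0#
    β≋0 = begin
      β              ≈⟨ ≈⇒≋ (xyx⁻¹≈y α β) ⟨
      (α + β) - α    ≈⟨ ≋-+ (∼⇒≋ 𝒪-one 1∼α+β) (≋-neg (∼⇒≋ 𝒪-one 1∼α)) ⟨
      1# - 1#        ≈⟨ ≈⇒≋ (-‿inverseʳ 1#) ⟩
      0#             ∎

  Σ-unit-complete : ∀ {z} → 𝓜Δ z → ΣH K Δ 1# z 1#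
  Σ-unit-complete {z} mz = 1# , z , ≈⇒∼ refl , ≈⇒∼ refl , z , mz , sym (*-identityˡ (1# + z))

  Σ-shift-sound : ∀ {a b z} → 𝒪 b → 𝓜Δ z → ΣH K Δ b z a → a ≋ b
  Σ-shift-sound {a} {b} {z} 𝒪b mz σ = begin
    a        ≈⟨ proj₂ (Σ-sound 𝒪b (𝓜⊆𝒪 mz) σ) ⟨
    b + z    ≈⟨ ≋-+ (≈⇒≋ refl) (𝓜⇒≋0 mz) ⟩
    b + 0#   ≈⟨ ≈⇒≋ (+-identityʳ b) ⟩
    b        ∎
    where open import Relation.Binary.Reasoning.Setoid ≋-setoid

  Σ-shift-complete : ∀ a b → ΣH K Δ b (a - b) a
  Σ-shift-complete a b = b , a - b , ≈⇒∼ refl , ≈⇒∼ refl ,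
    ≈⇒∼ (sym (trans (+-comm b (a - b)) (//-rightDividesˡ b a)))

wk : ∀ {n} → Term n → Term (ℕ.suc n)
wk (var i)  = var (suc i)
wk `0       = `0
wk `1       = `1
wk (s `· t) = wk s `· wk t

`𝓜 : ∀ {n} → Term n → Formula n
`𝓜 z = `Σ `1 z `1

`≋ : ∀ {n} → Term n → Term n → Formula n
`≋ a b = `∃ (`𝓜 (var zero) `∧ `Σ (wk b) (var zero) (wk a))

`graph : ∀ {n} → Term n → Term n → Formula n
`graph x u = (`P x `∧ (u `≐ x)) `∨ ((`P x `⇒ `⊥) `∧ (u `≐ `0))

-- x E y  :⇔ ∃u w (F(x,u) ∧ F(y,w) ∧ D(u,w)), and similarly for 0 and 1;
-- +(x,y,z) :⇔ ∃u w t (F(x,u) ∧ F(y,w) ∧ F(z,t) ∧ ∃s (Σ(u,w,s) ∧ D(s,t)));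
-- ·(x,y,z) :⇔ ∃u w t (F(x,u) ∧ F(y,w) ∧ F(z,t) ∧ D(u·w,t)).
Φ : InterpretationFormulas
Φ = record
  { φE = `∃ (`∃ (`graph (var (# 2)) (var (# 1)) `∧ (`graph (var (# 3)) (var (# 0))
           `∧ `≋ (var (# 1)) (var (# 0)))))
  ; φ+ = `∃ (`∃ (`∃ (`graph (var (# 3)) (var (# 2)) `∧ (`graph (var (# 4)) (var (# 1))
           `∧ (`graph (var (# 5)) (var (# 0))
           `∧ `∃ (`Σ (var (# 3)) (var (# 2)) (var (# 0)) `∧ `≋ (var (# 0)) (var (# 1))))))))
  ; φ· = `∃ (`∃ (`∃ (`graph (var (# 3)) (var (# 2)) `∧ (`graph (var (# 4)) (var (# 1))
           `∧ (`graph (var (# 5)) (var (# 0)) `∧ `≋ (var (# 2) `· var (# 1)) (var (# 0)))))))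
  ; φ0 = `∃ (`graph (var (# 1)) (var (# 0)) `∧ `≋ (var (# 0)) `0)
  ; φ1 = `∃ (`graph (var (# 1)) (var (# 0)) `∧ `≋ (var (# 0)) `1)
  }

module Interpretation {c ℓ g d} (K : ValuedField c ℓ g) (Δ : ValuedField.Γ K → Set d)
                      (Δ0 : Δ (ValuedField.0Γ K)) (em : ExcludedMiddle (c ⊔ ℓ ⊔ g ⊔ d)) where
  open ValuedField K
  open Valuation K
  open Ideal K Δ Δ0
  open Units K Δ Δ0
  open SumRelation K Δ Δ0
  open import Relation.Binary.Reasoning.Setoid ≋-setoid

  L : Level.Level
  L = c ⊔ ℓ ⊔ g ⊔ d

  H : LStructure c L
  H = HStr K Δ

  f : Carrier → Carrier
  f x with em {Lift L (𝒪 x)}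
  ... | yes _ = x
  ... | no  _ = 0#

  f-spec : ∀ x → (𝒪 x × f x ≡ x) ⊎ (¬ 𝒪 x × f x ≡ 0#)
  f-spec x with em {Lift L (𝒪 x)}
  ... | yes (lift 𝒪x) = inj₁ (𝒪x , ≡.refl)
  ... | no  ¬𝒪x       = inj₂ ((λ 𝒪x → ¬𝒪x (lift 𝒪x)) , ≡.refl)

  f-𝒪 : ∀ x → 𝒪 (f x)
  f-𝒪 x with f-spec x
  ... | inj₁ (𝒪x , eq) = subst 𝒪 (≡.sym eq) 𝒪x
  ... | inj₂ (_  , eq) = subst 𝒪 (≡.sym eq) 𝒪-zero

  f-fixes-𝒪 : ∀ a → 𝒪 a → f a ≋ a
  f-fixes-𝒪 a 𝒪a with f-spec a
  ... | inj₁ (_ , eq)    = ≈⇒≋ (reflexive eq)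
  ... | inj₂ (¬𝒪a , _)   = ⊥-elim (¬𝒪a 𝒪a)

  Graph : Carrier → Carrier → Set L
  Graph x u = Sat H (`graph (var (# 0)) (var (# 1))) (x ∷ u ∷ [])

  Congruent : Carrier → Carrier → Set L
  Congruent a b = Sat H (`≋ (var (# 0)) (var (# 1))) (a ∷ b ∷ [])

  graph-sound : ∀ x u → Graph x u → 𝒪 u × (f x ≋ u)
  graph-sound x u F with f-spec x
  graph-sound x u (inj₁ (lift (lift 𝒪x) , lift u∼x)) | inj₁ (_ , eq) =
    let 𝒪u = 𝒪-resp-v (≡.sym (∼-preserves-v u∼x)) 𝒪x
    in 𝒪u , subst (_≋ u) (≡.sym eq) (≋-sym (∼⇒≋ 𝒪u u∼x))
  graph-sound x u (inj₁ (lift (lift 𝒪x) , _)) | inj₂ (¬𝒪x , _) = ⊥-elim (¬𝒪x 𝒪x)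
  graph-sound x u (inj₂ (¬P , _)) | inj₁ (𝒪x , _) = ⊥-elim (lower (¬P (lift (lift 𝒪x))))
  graph-sound x u (inj₂ (_ , lift u∼0)) | inj₂ (_ , eq) =
    let 𝒪u = 𝒪-resp-v (≡.sym (∼-preserves-v u∼0)) 𝒪-zero
    in 𝒪u , subst (_≋ u) (≡.sym eq) (≋-sym (∼⇒≋ 𝒪u u∼0))

  graph-complete : ∀ x → Graph x (f x)
  graph-complete x with f-spec x
  ... | inj₁ (𝒪x , eq)  = inj₁ (lift (lift 𝒪x) , lift (≈⇒∼ (reflexive eq)))
  ... | inj₂ (¬𝒪x , eq) = inj₂ ((λ P → ⊥-elim (¬𝒪x (lower (lower P)))) , lift (≈⇒∼ (reflexive eq)))

  congruent-sound : ∀ a b → 𝒪 b → Congruent a b → a ≋ b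
  congruent-sound a b 𝒪b (z , lift σ₁ , lift σ) = Σ-shift-sound 𝒪b (Σ-unit-sound σ₁) σ

  congruent-complete : ∀ {a b} → a ≋ b → Congruent a b
  congruent-complete {a} {b} h = a - b , lift (Σ-unit-complete h) , lift (Σ-shift-complete a b)

  open InterpretationFormulas Φ

  equality : ∀ x y → Sat H φE (x ∷ y ∷ []) ⇔ (f x ≋ f y)
  equality x y = mk⇔ to (λ h → f x , f y , graph-complete x , graph-complete y , congruent-complete h)
    where
    to : Sat H φE (x ∷ y ∷ []) → f x ≋ f y
    to (u , w , Fxu , Fyw , D) with graph-sound x u Fxu | graph-sound y w Fyw
    ... | _ , fx≋u | 𝒪w , fy≋w = begin
      f x  ≈⟨ fx≋u ⟩
      u    ≈⟨ congruent-sound u w 𝒪w D ⟩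
      w    ≈⟨ fy≋w ⟨
      f y  ∎

  addition : ∀ x y z → Sat H φ+ (x ∷ y ∷ z ∷ []) ⇔ (f x + f y ≋ f z)
  addition x y z = mk⇔ to from
    where
    to : Sat H φ+ (x ∷ y ∷ z ∷ []) → f x + f y ≋ f z
    to (u , w , t , Fxu , Fyw , Fzt , s , lift σ , D)
      with graph-sound x u Fxu | graph-sound y w Fyw | graph-sound z t Fzt
    ... | 𝒪u , fx≋u | 𝒪w , fy≋w | 𝒪t , fz≋t with Σ-sound 𝒪u 𝒪w σ
    ... | _ , u+w≋s = begin
      f x + f y  ≈⟨ ≋-+ fx≋u fy≋w ⟩
      u + w      ≈⟨ u+w≋s ⟩
      s          ≈⟨ congruent-sound s t 𝒪t D ⟩
      t          ≈⟨ fz≋t ⟨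
      f z        ∎
    from : f x + f y ≋ f z → Sat H φ+ (x ∷ y ∷ z ∷ [])
    from h = f x , f y , f z , graph-complete x , graph-complete y , graph-complete z ,
             f x + f y , lift (Σ-complete (f x) (f y)) , congruent-complete h

  multiplication : ∀ x y z → Sat H φ· (x ∷ y ∷ z ∷ []) ⇔ (f x * f y ≋ f z)
  multiplication x y z = mk⇔ to from
    where
    to : Sat H φ· (x ∷ y ∷ z ∷ []) → f x * f y ≋ f z
    to (u , w , t , Fxu , Fyw , Fzt , D)
      with graph-sound x u Fxu | graph-sound y w Fyw | graph-sound z t Fzt
    ... | 𝒪u , fx≋u | _ , fy≋w | 𝒪t , fz≋t = begin
      f x * f y  ≈⟨ ≋-* 𝒪u (f-𝒪 y) fx≋u fy≋w ⟩
      u * w      ≈⟨ congruent-sound (u * w) t 𝒪t D ⟩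
      t          ≈⟨ fz≋t ⟨
      f z        ∎
    from : f x * f y ≋ f z → Sat H φ· (x ∷ y ∷ z ∷ [])
    from h = f x , f y , f z , graph-complete x , graph-complete y , graph-complete z ,
             congruent-complete h

  constant : ∀ e → 𝒪 e → ∀ x → (Σ Carrier λ u → Graph x u × Congruent u e) ⇔ (f x ≋ e)
  constant e 𝒪e x = mk⇔ to (λ h → f x , graph-complete x , congruent-complete h)
    where
    to : (Σ Carrier λ u → Graph x u × Congruent u e) → f x ≋ e
    to (u , Fxu , D) with graph-sound x u Fxu
    ... | _ , fx≋u = begin
      f x  ≈⟨ fx≋u ⟩
      u    ≈⟨ congruent-sound u e 𝒪e D ⟩
      e    ∎

  interpretation : Interprets K Δ Φ
  interpretation = f , f-𝒪 , (λ a 𝒪a → a , f-fixes-𝒪 a 𝒪a) , equality , addition , multiplication ,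
                   constant 0# 𝒪-zero , constant 1# 𝒪-one

mainTheorem12 : ∃ω {InterpretationFormulas} λ Φ →
    ∀ {c ℓ g d} (K : ValuedField c ℓ g) (Δ : ValuedField.Γ K → Set d) →
    Convex K Δ → Δ (ValuedField.0Γ K) →
    ExcludedMiddle (c ⊔ ℓ ⊔ g ⊔ d) →
    Interprets K Δ Φ
mainTheorem12 = Φ ,ω λ K Δ _ Δ0 em → Interpretation.interpretation K Δ Δ0 em
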